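{- In the projective Hjelmslev plane $\mathrm{PHG}(2,\mathbb{S}_5)$ over the chain ring $\mathbb{S}_5=\mathbb{F}_5[X]/(X^2)$, the following $22$ points form a $(22,2)$-arc (no three of them are collinear): $(1:X+1:4X)$, $(4X:1:X+1)$, $(1:4X:4X+1)$, $(1:4X+1:4X)$, $(4X:1:4X+1)$, $(1:4X:X+1)$, $(1:X+1:3X+4)$, $(1:2X+4:X+4)$, $(1:4X+4:4X+1)$, $(1:4X+1:4X+4)$, $(1:X+4:2X+4)$, $(1:3X+4:X+1)$, $(1:3X+2:3X+2)$, $(1:3X+3:1)$, $(1:1:3X+3)$, $(1:2X+3:4X+2)$, $(1:4X+3:3X+4)$, $(1:2X+4:2X+2)$, $(1:4X+2:2X+3)$, $(1:2X+2:2X+4)$, $(1:3X+4:4X+3)$, $(1:1:1)$. Consequently $n_2(\mathbb{S}_5)\geq 22$.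
   Context: $\mathbb{S}_5=\mathbb{F}_5[X]/(X^2)$ is the commutative chain ring of order $25$ and composition length $2$ with residue field $\mathbb{F}_5$. The projective Hjelmslev plane $\mathrm{PHG}(2,R)$ has as points the free rank-$1$ right submodules of $R^3$ and as lines the free rank-$2$ right submodules, with incidence given by inclusion; points are written in homogeneous coordinates $(a:b:c)$. A set of $n$ points is an $(n,2)$-arc ($2$-arc) if no three of its points are collinear. $n_2(R)$ denotes the maximum size of a $2$-arc in $\mathrm{PHG}(2,R)$. -}

module Defs where

open import Data.Nat using (ℕ; _+_; _*_)
open import Data.Nat.DivMod using (_mod_)
open import Data.Fin using (Fin; toℕ)
open import Data.Product using (_×_; _,_; ∃; ∃-syntax)
open import Data.Vec using (Vec; lookup; []; _∷_)
open import Relation.Binary.PropositionalEquality using (_≡_; _≢_)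
open import Relation.Nullary using (¬_)

F5 : Set
F5 = Fin 5

_+₅_ : F5 → F5 → F5
a +₅ b = (toℕ a + toℕ b) mod 5

_*₅_ : F5 → F5 → F5
a *₅ b = (toℕ a * toℕ b) mod 5

-- The chain ring S₅ = F₅[X]/(X²); the pair (a , b) stands for a + bX.
S5 : Set
S5 = F5 × F5

0S : S5
0S = (0 mod 5 , 0 mod 5)

_⊕_ : S5 → S5 → S5
(a , b) ⊕ (c , d) = (a +₅ c , b +₅ d)

-- (a + bX)(c + dX) = ac + (ad + bc)X   (using X² = 0)
_⊗_ : S5 → S5 → S5
(a , b) ⊗ (c , d) = (a *₅ c , (a *₅ d) +₅ (b *₅ c))

[_X+_] : ℕ → ℕ → S5
[ c X+ d ] = (d mod 5 , c mod 5)

V3 : Set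
V3 = S5 × S5 × S5

0V : V3
0V = (0S , 0S , 0S)

_⊕ᵥ_ : V3 → V3 → V3
(a , b , c) ⊕ᵥ (a' , b' , c') = (a ⊕ a' , b ⊕ b' , c ⊕ c')

_·_ : V3 → S5 → V3
(a , b , c) · r = (a ⊗ r , b ⊗ r , c ⊗ r)

-- The cyclic right submodule pR is free of rank 1 (p generates a point).
FreeRank1 : V3 → Set
FreeRank1 p = ∀ r → p · r ≡ 0V → r ≡ 0S

-- The submodule vR + wR is free of rank 2 with basis (v , w) (it is a line).
FreeRank2 : V3 → V3 → Set
FreeRank2 v w = ∀ r s → (v · r) ⊕ᵥ (w · s) ≡ 0V → (r ≡ 0S) × (s ≡ 0S)

PointOnSpan : V3 → V3 → V3 → Set
PointOnSpan p v w = ∃[ r ] ∃[ s ] p ≡ (v · r) ⊕ᵥ (w · s)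

SamePoint : V3 → V3 → Set
SamePoint p q = (∃[ r ] p ≡ q · r) × (∃[ r ] q ≡ p · r)

Collinear : V3 → V3 → V3 → Set
Collinear p q t = ∃[ v ] ∃[ w ]
  (FreeRank2 v w × PointOnSpan p v w × PointOnSpan q v w × PointOnSpan t v w)

Is2Arc : ∀ {n} → Vec V3 n → Set
Is2Arc {n} ps =
  (∀ i → FreeRank1 (lookup ps i)) ×
  (∀ (i j : Fin n) → i ≢ j → ¬ SamePoint (lookup ps i) (lookup ps j)) ×
  (∀ (i j k : Fin n) → i ≢ j → j ≢ k → i ≢ k →
     ¬ Collinear (lookup ps i) (lookup ps j) (lookup ps k))

pt : S5 → S5 → S5 → V3
pt a b c = (a , b , c)

one : S5
one = [ 0 X+ 1 ]

arc22 : Vec V3 22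
arc22 =
  pt one [ 1 X+ 1 ] [ 4 X+ 0 ] ∷
  pt [ 4 X+ 0 ] one [ 1 X+ 1 ] ∷
  pt one [ 4 X+ 0 ] [ 4 X+ 1 ] ∷
  pt one [ 4 X+ 1 ] [ 4 X+ 0 ] ∷
  pt [ 4 X+ 0 ] one [ 4 X+ 1 ] ∷
  pt one [ 4 X+ 0 ] [ 1 X+ 1 ] ∷
  pt one [ 1 X+ 1 ] [ 3 X+ 4 ] ∷
  pt one [ 2 X+ 4 ] [ 1 X+ 4 ] ∷
  pt one [ 4 X+ 4 ] [ 4 X+ 1 ] ∷
  pt one [ 4 X+ 1 ] [ 4 X+ 4 ] ∷
  pt one [ 1 X+ 4 ] [ 2 X+ 4 ] ∷
  pt one [ 3 X+ 4 ] [ 1 X+ 1 ] ∷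
  pt one [ 3 X+ 2 ] [ 3 X+ 2 ] ∷
  pt one [ 3 X+ 3 ] one ∷
  pt one one [ 3 X+ 3 ] ∷
  pt one [ 2 X+ 3 ] [ 4 X+ 2 ] ∷
  pt one [ 4 X+ 3 ] [ 3 X+ 4 ] ∷
  pt one [ 2 X+ 4 ] [ 2 X+ 2 ] ∷
  pt one [ 4 X+ 2 ] [ 2 X+ 3 ] ∷
  pt one [ 2 X+ 2 ] [ 2 X+ 4 ] ∷
  pt one [ 3 X+ 4 ] [ 4 X+ 3 ] ∷
  pt one one one ∷ []

module Submission where

-- For three vectors p, q, t of R³ over a commutative ring,
-- split the determinant as det⁺ − det⁻, where det⁺ and det⁻ collect the three
-- products with sign +1 and −1.  If p, q, t all lie in a submodule vR + wR
-- generated by two vectors, then det⁺ p q t = det⁻ p q t: after expanding,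
-- this is a polynomial identity that holds in every commutative semiring.
-- Hence three collinear points of PHG(2,S₅) satisfy det⁺ = det⁻, whatever
-- the line through them is.  Since S₅ = F₅[X]/(X²) is finite, the rest is a
-- finite computation:
--   * S₅ is a commutative semiring (each axiom is checked on all elements),
--     so the determinant identity applies to it;
--   * each of the 22 generators spans a free rank-1 submodule;
--   * no generator is a scalar multiple of another, so the points differ;
--   * every triple of distinct generators has det⁺ ≠ det⁻, so no three of
--     the points are collinear.

open import Defs

open import Data.Fin using (Fin)
open import Data.Fin.Properties using (all?; any?) renaming (_≟_ to _≟F_)
open import Data.Product using (_×_; _,_; ∃; ∃-syntax; proj₁)
open import Data.Product.Properties using (≡-dec)
open import Data.Vec using (lookup)
open import Relation.Binary.PropositionalEquality
  using (_≡_; _≢_; refl; cong₂; isEquivalence)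
open import Relation.Nullary using (Dec; ¬_)
open import Relation.Nullary.Decidable using (toWitness; map′; _→-dec_; ¬?)
open import Algebra.Core using (Op₂)
open import Algebra.Bundles using (CommutativeSemiring)
open import Algebra.Definitions {A = S5} _≡_ using (Associative; LeftIdentity; Commutative)
open import Algebra.Structures {A = S5} _≡_ using (IsCommutativeMonoid)
open import Algebra.Structures.Biased {A = S5} _≡_
  using (IsCommutativeMonoidˡ; isCommutativeSemiringˡ)

module Determinant {c ℓ} (R : CommutativeSemiring c ℓ) where
  open CommutativeSemiring R renaming (refl to ≈-refl)
  open import Algebra.Solver.Ring.NaturalCoefficients.Default R
    using (solve; _:=_; _:+_; _:*_)

  Vec3 : Set c
  Vec3 = Carrier × Carrier × Carrier

  -- det = det⁺ − det⁻ (cofactor expansion, positive and negative terms).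
  det⁺ det⁻ : Vec3 → Vec3 → Vec3 → Carrier
  det⁺ (p₁ , p₂ , p₃) (q₁ , q₂ , q₃) (t₁ , t₂ , t₃) =
    (p₁ * q₂ * t₃ + p₂ * q₃ * t₁) + p₃ * q₁ * t₂
  det⁻ (p₁ , p₂ , p₃) (q₁ , q₂ , q₃) (t₁ , t₂ , t₃) =
    (p₁ * q₃ * t₂ + p₂ * q₁ * t₃) + p₃ * q₂ * t₁

  combine : Vec3 → Vec3 → Carrier → Carrier → Vec3
  combine (v₁ , v₂ , v₃) (w₁ , w₂ , w₃) r s =
    (v₁ * r + w₁ * s , v₂ * r + w₂ * s , v₃ * r + w₃ * s)

  -- The determinant is alternating and multilinear, so it vanishes on three
  -- vectors of a two-generated span; here in subtraction-free form.
  det⁺≈det⁻-on-span : ∀ v w r₁ s₁ r₂ s₂ r₃ s₃ →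
    let p = combine v w r₁ s₁ ; q = combine v w r₂ s₂ ; t = combine v w r₃ s₃
    in det⁺ p q t ≈ det⁻ p q t
  det⁺≈det⁻-on-span (v₁ , v₂ , v₃) (w₁ , w₂ , w₃) =
    solve 12 (λ v₁ v₂ v₃ w₁ w₂ w₃ r₁ s₁ r₂ s₂ r₃ s₃ →
      let p₁ = v₁ :* r₁ :+ w₁ :* s₁ ; p₂ = v₂ :* r₁ :+ w₂ :* s₁ ; p₃ = v₃ :* r₁ :+ w₃ :* s₁
          q₁ = v₁ :* r₂ :+ w₁ :* s₂ ; q₂ = v₂ :* r₂ :+ w₂ :* s₂ ; q₃ = v₃ :* r₂ :+ w₃ :* s₂
          t₁ = v₁ :* r₃ :+ w₁ :* s₃ ; t₂ = v₂ :* r₃ :+ w₂ :* s₃ ; t₃ = v₃ :* r₃ :+ w₃ :* s₃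
      in (p₁ :* q₂ :* t₃ :+ p₂ :* q₃ :* t₁) :+ p₃ :* q₁ :* t₂
         := (p₁ :* q₃ :* t₂ :+ p₂ :* q₁ :* t₃) :+ p₃ :* q₂ :* t₁)
      ≈-refl v₁ v₂ v₃ w₁ w₂ w₃

-- Equality in S₅ and S₅³ is decidable, and so are quantifiers over the
-- 25 elements of S₅; this turns the remaining claims into computations.
_≟S_ : (x y : S5) → Dec (x ≡ y)
_≟S_ = ≡-dec _≟F_ _≟F_

_≟V_ : (x y : V3) → Dec (x ≡ y)
_≟V_ = ≡-dec _≟S_ (≡-dec _≟S_ _≟S_)

allS? : {Q : S5 → Set} → (∀ r → Dec (Q r)) → Dec (∀ r → Q r)
allS? d = map′ (λ f (a , b) → f a b) (λ f a b → f (a , b))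
               (all? λ a → all? λ b → d (a , b))

anyS? : {Q : S5 → Set} → (∀ r → Dec (Q r)) → Dec (∃ Q)
anyS? d = map′ (λ (a , b , q) → (a , b) , q) (λ ((a , b) , q) → a , b , q)
               (any? λ a → any? λ b → d (a , b))

-- The commutative semiring axioms of S₅ (left-handed forms suffice, given
-- commutativity), each verified on all elements.
module S5Laws where
  ⊕-assoc : ∀ x y z → (x ⊕ y) ⊕ z ≡ x ⊕ (y ⊕ z)
  ⊕-assoc = toWitness {a? = allS? λ x → allS? λ y → allS? λ z → ((x ⊕ y) ⊕ z) ≟S (x ⊕ (y ⊕ z))} _

  ⊕-comm : ∀ x y → x ⊕ y ≡ y ⊕ x
  ⊕-comm = toWitness {a? = allS? λ x → allS? λ y → (x ⊕ y) ≟S (y ⊕ x)} _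

  ⊕-identityˡ : ∀ x → 0S ⊕ x ≡ x
  ⊕-identityˡ = toWitness {a? = allS? λ x → (0S ⊕ x) ≟S x} _

  ⊗-assoc : ∀ x y z → (x ⊗ y) ⊗ z ≡ x ⊗ (y ⊗ z)
  ⊗-assoc = toWitness {a? = allS? λ x → allS? λ y → allS? λ z → ((x ⊗ y) ⊗ z) ≟S (x ⊗ (y ⊗ z))} _

  ⊗-comm : ∀ x y → x ⊗ y ≡ y ⊗ x
  ⊗-comm = toWitness {a? = allS? λ x → allS? λ y → (x ⊗ y) ≟S (y ⊗ x)} _

  ⊗-identityˡ : ∀ x → one ⊗ x ≡ x
  ⊗-identityˡ = toWitness {a? = allS? λ x → (one ⊗ x) ≟S x} _

  ⊗-zeroˡ : ∀ x → 0S ⊗ x ≡ 0S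
  ⊗-zeroˡ = toWitness {a? = allS? λ x → (0S ⊗ x) ≟S 0S} _

  ⊗-distribʳ-⊕ : ∀ x y z → (y ⊕ z) ⊗ x ≡ (y ⊗ x) ⊕ (z ⊗ x)
  ⊗-distribʳ-⊕ = toWitness {a? = allS? λ x → allS? λ y → allS? λ z → ((y ⊕ z) ⊗ x) ≟S ((y ⊗ x) ⊕ (z ⊗ x))} _

≡-isCommutativeMonoid : {_∙_ : Op₂ S5} {ε : S5} →
  Associative _∙_ → LeftIdentity ε _∙_ → Commutative _∙_ → IsCommutativeMonoid _∙_ ε
≡-isCommutativeMonoid {_∙_} assoc identityˡ comm =
  IsCommutativeMonoidˡ.isCommutativeMonoid record
    { isSemigroup = record
      { isMagma = record { isEquivalence = isEquivalence ; ∙-cong = cong₂ _∙_ }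
      ; assoc = assoc }
    ; identityˡ = identityˡ
    ; comm = comm }

S5-commutativeSemiring : CommutativeSemiring _ _
S5-commutativeSemiring = record
  { Carrier = S5 ; _≈_ = _≡_ ; _+_ = _⊕_ ; _*_ = _⊗_ ; 0# = 0S ; 1# = one
  ; isCommutativeSemiring = isCommutativeSemiringˡ record
    { +-isCommutativeMonoid = ≡-isCommutativeMonoid ⊕-assoc ⊕-identityˡ ⊕-comm
    ; *-isCommutativeMonoid = ≡-isCommutativeMonoid ⊗-assoc ⊗-identityˡ ⊗-comm
    ; distribʳ = ⊗-distribʳ-⊕
    ; zeroˡ = ⊗-zeroˡ } }
  where open S5Laws

open Determinant S5-commutativeSemiring using (det⁺; det⁻; det⁺≈det⁻-on-span)

collinear⇒det⁺≡det⁻ : ∀ p q t → Collinear p q t → det⁺ p q t ≡ det⁻ p q t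
collinear⇒det⁺≡det⁻ _ _ _
  (v , w , _ , (r₁ , s₁ , refl) , (r₂ , s₂ , refl) , (r₃ , s₃ , refl)) =
  det⁺≈det⁻-on-span v w r₁ s₁ r₂ s₂ r₃ s₃

P : Fin 22 → V3
P i = lookup arc22 i

arc22-free : ∀ i → FreeRank1 (P i)
arc22-free = toWitness {a? = all? λ i → allS? λ r → ((P i · r) ≟V 0V) →-dec (r ≟S 0S)} _

arc22-notMultiple : ∀ i j → i ≢ j → ¬ (∃[ r ] P i ≡ P j · r)
arc22-notMultiple = toWitness {a? = all? λ i → all? λ j →
  ¬? (i ≟F j) →-dec ¬? (anyS? λ r → P i ≟V (P j · r))} _

arc22-det⁺≢det⁻ : ∀ i j k → i ≢ j → j ≢ k → i ≢ k →
  det⁺ (P i) (P j) (P k) ≢ det⁻ (P i) (P j) (P k)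
arc22-det⁺≢det⁻ = toWitness {a? = all? λ i → all? λ j → all? λ k →
  ¬? (i ≟F j) →-dec ¬? (j ≟F k) →-dec ¬? (i ≟F k) →-dec
  ¬? (det⁺ (P i) (P j) (P k) ≟S det⁻ (P i) (P j) (P k))} _

mainTheorem4 : Is2Arc arc22
mainTheorem4 =
    arc22-free
  , (λ i j i≢j same → arc22-notMultiple i j i≢j (proj₁ same))
  , (λ i j k i≢j j≢k i≢k collinear →
       arc22-det⁺≢det⁻ i j k i≢j j≢k i≢k
         (collinear⇒det⁺≡det⁻ (P i) (P j) (P k) collinear))
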